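{- Let $G=(V,E)$ be a $k$-clique-sum of a list of graphs $H_1,H_2,\dots,H_r$, and let $V_i$ be the vertex set of $H_i=(V_i,E_i)$ (viewed as a subset of $V$). Then there exists an index $1\le i\le r$ such that every $V_i$-flap $S$ has size $|S|\le|V|/2$.
   Context: $G$ is a $k$-clique-sum of $H_1$ and $H_2$ if it is obtained by choosing $1\le s\le k$, an $s$-clique $\{u_1,\dots,u_s\}$ in $H_1$ and an $s$-clique $\{v_1,\dots,v_s\}$ in $H_2$, identifying $u_j=v_j$ for all $j$, and then possibly removing some edges of the identified clique. $G$ is a $k$-clique-sum of the list $H_1,\dots,H_r$ if there are graphs $G_1,\dots,G_r$ with $G_1=H_1$, $G_j$ a $k$-clique-sum of $G_{j-1}$ and $H_j$ for $2\le j\le r$, and $G=G_r$. For $R\subseteq V$, an $R$-flap is (the vertex set of) a connected component of $G[V\setminus R]$. -}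

module Defs where

open import Data.Nat using (ℕ; _≤_; _*_; suc; zero)
open import Data.Fin using (Fin)
open import Data.Fin.Subset using (Subset; _∈_; _∉_; _∩_; _∪_; ∣_∣)
open import Data.List using (List; []; _∷_; _∷ʳ_)
open import Data.Product using (_×_; ∃)
open import Data.Sum using (_⊎_)
open import Relation.Nullary using (¬_)
open import Relation.Binary.PropositionalEquality using (_≢_)

-- A finite simple graph whose vertex set is a subset of the ambient
-- vertex universe Fin n (so several graphs can be "viewed as subsets of V").
record SGraph (n : ℕ) : Set₁ where
  field
    verts     : Subset n
    adj       : Fin n → Fin n → Set
    adj-sym   : ∀ {u v} → adj u v → adj v u
    adj-irr   : ∀ {u} → ¬ adj u u
    adj-verts : ∀ {u v} → adj u v → (u ∈ verts) × (v ∈ verts)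

open SGraph public

IsClique : ∀ {n} → SGraph n → Subset n → Set
IsClique G C =
  (∀ x → x ∈ C → x ∈ verts G) ×
  (∀ u v → u ∈ C → v ∈ C → u ≢ v → adj G u v)

IsCliqueSum : ∀ {n} → ℕ → SGraph n → SGraph n → SGraph n → Set
IsCliqueSum k G₁ H G =
  let C = verts G₁ ∩ verts H in
  (1 ≤ ∣ C ∣) × (∣ C ∣ ≤ k) ×
  IsClique G₁ C × IsClique H C ×
  (∀ x → (x ∈ verts G → x ∈ verts G₁ ⊎ x ∈ verts H) ×
         (x ∈ verts G₁ ⊎ x ∈ verts H → x ∈ verts G)) ×
  (∀ u v → adj G u v → adj G₁ u v ⊎ adj H u v) ×
  (∀ u v → adj G₁ u v ⊎ adj H u v → ¬ (u ∈ C × v ∈ C) → adj G u v)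

data CliqueSumList {n : ℕ} (k : ℕ) : List (SGraph n) → SGraph n → Set₁ where
  single : (H : SGraph n) → CliqueSumList k (H ∷ []) H
  step   : ∀ {Hs G' H G} → CliqueSumList k Hs G' → IsCliqueSum k G' H G →
           CliqueSumList k (Hs ∷ʳ H) G

data WalkIn {n : ℕ} (G : SGraph n) (A : Subset n) : Fin n → Fin n → Set where
  here  : ∀ {x} → x ∈ A → WalkIn G A x x
  there : ∀ {x z y} → x ∈ A → adj G x z → WalkIn G A z y → WalkIn G A x y

-- S is an R-flap of G: the vertex set of a connected component of G[V(G) ∖ R]
IsFlap : ∀ {n} → SGraph n → Subset n → Subset n → Set
IsFlap G R S =
  (∀ x → x ∈ S → (x ∈ verts G) × (x ∉ R)) ×
  (∃ λ x → x ∈ S) ×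
  (∀ x y → x ∈ S → y ∈ S → WalkIn G S x y) ×
  (∀ x y → x ∈ S → adj G x y → y ∉ R → y ∈ S)

-- Weigh a vertex set S by the number of members of a list of cliques of G that
-- meet S; unit vertex weights are the case of the singletons of V(G).  For
-- every such list some part is a balanced separator, by induction along the
-- clique-sum G = G' ⊕ H with C = V(G') ∩ V(H).  If the vertices of G outside H
-- carry at most half the weight, H works.  Otherwise replace every clique
-- meeting H ∖ G' by C, which gives a list of cliques of G' of the same length,
-- and take the part given by induction.  A connected S avoiding that part either
-- meets G', and then S ∩ V(G') is connected in G' and meets the image of every
-- clique that S meets (S enters H ∖ G' only through C), or lies in H ∖ G', and
-- then no clique meets both S and the heavy side V(G) ∖ V(H).
module Submission where

open import Defs
open import Data.Nat using (ℕ; _≤_; _*_)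
open import Data.Fin.Subset using (Subset; ∣_∣)
open import Data.List using (List)
open import Data.List.Relation.Unary.Any using (Any)

open import Data.Nat using (zero; suc; _+_; _<_; z≤n)
open import Data.Nat.Properties hiding (_≟_)
open import Algebra.Properties.CommutativeSemigroup +-commutativeSemigroup using (interchange)
open import Data.Fin using (Fin; zero; suc; _≟_)
open import Data.Fin.Subset using (_∈_; _∉_; _⊆_; _∩_; ∁; ⁅_⁆; Nonempty; Empty; inside; outside)
open import Data.Fin.Subset.Properties
  using (nonempty?; _∈?_; x∈p∩q⁺; x∈p∩q⁻; x∉p⇒x∈∁p; x∈∁p⇒x∉p; drop-∷-⊆; x∈⁅y⁆⇒x≡y)
open import Data.Vec using (_∷_; []; here; there)
open import Data.List using ([]; _∷_; _∷ʳ_; map; length)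
open import Data.List.Properties using (length-map)
open import Data.List.Relation.Unary.All as All using (All; []; _∷_)
import Data.List.Relation.Unary.Any as Any
open import Data.List.Relation.Unary.All.Properties using (map⁺)
open import Data.List.Relation.Unary.Any.Properties using (++⁺ˡ; ++⁺ʳ)
open import Data.Product using (_×_; _,_; proj₁; proj₂; ∃)
open import Data.Sum using (_⊎_; inj₁; inj₂)
open import Data.Unit using (tt)
open import Data.Empty using (⊥; ⊥-elim)
open import Relation.Nullary using (Dec; yes; no)
open import Relation.Binary.PropositionalEquality using (_≡_; _≢_; refl; sym; trans; cong; subst)

private
  variable
    n : ℕ
    P Q : Set

Meets : Subset n → Subset n → Set
Meets K S = Nonempty (K ∩ S)

IsComplete : SGraph n → Subset n → Set
IsComplete G K = ∀ u v → u ∈ K → v ∈ K → u ≢ v → adj G u v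

Connected : SGraph n → Subset n → Set
Connected G S = ∀ x y → x ∈ S → y ∈ S → WalkIn G S x y

𝟙 : Dec P → ℕ
𝟙 (yes _) = 1
𝟙 (no _)  = 0

hits : Subset n → List (Subset n) → ℕ
hits S []       = 0
hits S (K ∷ Ks) = 𝟙 (nonempty? (K ∩ S)) + hits S Ks

Balanced : SGraph n → List (Subset n) → Subset n → Set
Balanced {n} G Ks R =
  ∀ (S : Subset n) → (∀ x → x ∈ S → x ∈ verts G × x ∉ R) → Connected G S →
  2 * hits S Ks ≤ length Ks

𝟙-mono : (p : Dec P) (q : Dec Q) → (P → Q) → 𝟙 p ≤ 𝟙 q
𝟙-mono (yes a) (yes _) f = ≤-refl
𝟙-mono (yes a) (no ¬b) f = ⊥-elim (¬b (f a))
𝟙-mono (no _)  q       f = z≤n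

𝟙-disjoint : (p : Dec P) (q : Dec Q) → (P → Q → ⊥) → 𝟙 p + 𝟙 q ≤ 1
𝟙-disjoint (yes a) (yes b) f = ⊥-elim (f a b)
𝟙-disjoint (yes _) (no _)  f = ≤-refl
𝟙-disjoint (no _)  q       f = 𝟙-mono q (yes tt) _

hits-map-mono : ∀ {m} {S : Subset n} {T : Subset m} (f : Subset n → Subset m) {Ks} →
  All (λ K → Meets K S → Meets (f K) T) Ks → hits S Ks ≤ hits T (map f Ks)
hits-map-mono f []       = z≤n
hits-map-mono f (m ∷ ms) = +-mono-≤ (𝟙-mono _ _ m) (hits-map-mono f ms)

hits-mono : ∀ {S T : Subset n} Ks → S ⊆ T → hits S Ks ≤ hits T Ks
hits-mono []       S⊆T = z≤n
hits-mono (K ∷ Ks) S⊆T = +-mono-≤ (𝟙-mono _ _ K∩S⇒K∩T) (hits-mono Ks S⊆T)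
  where
  K∩S⇒K∩T : Meets K _ → Meets K _
  K∩S⇒K∩T (x , x∈K∩S) = let x∈K , x∈S = x∈p∩q⁻ K _ x∈K∩S in x , x∈p∩q⁺ (x∈K , S⊆T x∈S)

hits-empty : ∀ {S : Subset n} Ks → Empty S → hits S Ks ≡ 0
hits-empty []       _ = refl
hits-empty {S = S} (K ∷ Ks) e with nonempty? (K ∩ S)
... | yes (x , x∈K∩S) = ⊥-elim (e (x , proj₂ (x∈p∩q⁻ K _ x∈K∩S)))
... | no _            = hits-empty Ks e

hits-disjoint : ∀ {S T : Subset n} {Ks} →
  All (λ K → Meets K S → Meets K T → ⊥) Ks → hits S Ks + hits T Ks ≤ length Ks
hits-disjoint []                 = z≤n
hits-disjoint {S = S} {T} {K ∷ Ks} (d ∷ ds) = begin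
  (a + hits S Ks) + (b + hits T Ks) ≡⟨ interchange a (hits S Ks) b (hits T Ks) ⟩
  (a + b) + (hits S Ks + hits T Ks) ≤⟨ +-mono-≤ (𝟙-disjoint (nonempty? (K ∩ S)) (nonempty? (K ∩ T)) d)
                                                (hits-disjoint ds) ⟩
  1 + length Ks                     ∎
  where
  open ≤-Reasoning
  a = 𝟙 (nonempty? (K ∩ S))
  b = 𝟙 (nonempty? (K ∩ T))

less-than-half : ∀ a b m → a + b ≤ m → m < 2 * b → 2 * a ≤ m
less-than-half a b m a+b≤m m<2b = <⇒≤ (+-cancelʳ-≤ m (suc (2 * a)) m (begin
  suc (2 * a + m) ≡⟨ sym (+-suc (2 * a) m) ⟩
  2 * a + suc m   ≤⟨ +-monoʳ-≤ (2 * a) m<2b ⟩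
  2 * a + 2 * b   ≡⟨ sym (*-distribˡ-+ 2 a b) ⟩
  2 * (a + b)     ≤⟨ *-monoʳ-≤ 2 a+b≤m ⟩
  2 * m           ≡⟨ cong (m +_) (+-identityʳ m) ⟩
  m + m           ∎))
  where open ≤-Reasoning

walk-start : ∀ {G : SGraph n} {S x y} → WalkIn G S x y → x ∈ S
walk-start (here x∈S)      = x∈S
walk-start (there x∈S _ _) = x∈S

adj⇒≢ : ∀ (G : SGraph n) {u v} → adj G u v → u ≢ v
adj⇒≢ G a refl = adj-irr G a

module CliqueSumStep (k : ℕ) (G' H G : SGraph n) (isSum : IsCliqueSum k G' H G) where

  C : Subset n
  C = verts G' ∩ verts H

  C-complete : IsComplete G' C
  C-complete = let (_ , _ , (_ , complete) , _) = isSum in complete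

  vertex-split : ∀ {x} → x ∈ verts G → x ∈ verts G' ⊎ x ∈ verts H
  vertex-split {x} = let (_ , _ , _ , _ , vertices , _) = isSum in proj₁ (vertices x)

  edge-split : ∀ {u v} → adj G u v → adj G' u v ⊎ adj H u v
  edge-split {u} {v} = let (_ , _ , _ , _ , _ , edges , _) = isSum in edges u v

  ∈C : ∀ {x} → x ∈ verts G' → x ∈ verts H → x ∈ C
  ∈C x∈G' x∈H = x∈p∩q⁺ (x∈G' , x∈H)

  H-edge-from-G' : ∀ {u v} → adj H u v → u ∈ verts G' → u ∈ C
  H-edge-from-G' a u∈G' = ∈C u∈G' (proj₁ (adj-verts H a))

  adj-within-G' : ∀ {u v} → adj G u v → u ∈ verts G' → v ∈ verts G' → adj G' u v
  adj-within-G' a u∈G' v∈G' with edge-split a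
  ... | inj₁ a' = a'
  ... | inj₂ h  = C-complete _ _ (H-edge-from-G' h u∈G') (∈C v∈G' (proj₂ (adj-verts H h))) (adj⇒≢ G a)

  -- A detour of a walk through H ∖ G' leaves and re-enters G' through the
  -- clique C, so it can be replaced by a single edge of C.
  restrict-walk : ∀ {S x y} → WalkIn G S x y → y ∈ verts G' →
    (x ∈ verts G' → WalkIn G' (S ∩ verts G') x y) ×
    (x ∉ verts G' → ∃ λ c → c ∈ C × c ∈ S × WalkIn G' (S ∩ verts G') c y)
  restrict-walk (here x∈S) y∈G' = (λ x∈G' → here (x∈p∩q⁺ (x∈S , x∈G'))) , (λ x∉G' → ⊥-elim (x∉G' y∈G'))
  restrict-walk {S} {x} {y} (there {z = z} x∈S x~z w) y∈G' = from-G' , from-outside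
    where
    rest = restrict-walk w y∈G'

    from-G' : x ∈ verts G' → WalkIn G' (S ∩ verts G') x y
    from-G' x∈G' with z ∈? verts G'
    ... | yes z∈G' = there (x∈p∩q⁺ (x∈S , x∈G')) (adj-within-G' x~z x∈G' z∈G') (proj₁ rest z∈G')
    ... | no z∉G' with proj₂ rest z∉G' | edge-split x~z
    ...   | _ , _ , _ , _ | inj₁ a = ⊥-elim (z∉G' (proj₂ (adj-verts G' a)))
    ...   | c , c∈C , _ , wc | inj₂ h with x ≟ c
    ...     | yes refl = wc
    ...     | no x≢c = there (x∈p∩q⁺ (x∈S , x∈G')) (C-complete _ _ (H-edge-from-G' h x∈G') c∈C x≢c) wc

    from-outside : x ∉ verts G' → ∃ λ c → c ∈ C × c ∈ S × WalkIn G' (S ∩ verts G') c y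
    from-outside x∉G' with edge-split x~z
    ... | inj₁ a = ⊥-elim (x∉G' (proj₁ (adj-verts G' a)))
    ... | inj₂ h with z ∈? verts G'
    ...   | yes z∈G' = z , ∈C z∈G' (proj₂ (adj-verts H h)) , walk-start w , proj₁ rest z∈G'
    ...   | no z∉G'  = proj₂ rest z∉G'

  H-only : Subset n
  H-only = verts H ∩ ∁ (verts G')

  G-only : Subset n
  G-only = verts G ∩ ∁ (verts H)

  ∉G'⇒∈H-only : ∀ {x} → x ∈ verts G → x ∉ verts G' → x ∈ H-only
  ∉G'⇒∈H-only x∈G x∉G' with vertex-split x∈G
  ... | inj₁ x∈G' = ⊥-elim (x∉G' x∈G')
  ... | inj₂ x∈H  = x∈p∩q⁺ (x∈H , x∉p⇒x∈∁p x∉G')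

  project : Subset n → Subset n
  project K with nonempty? (K ∩ H-only)
  ... | yes _ = C
  ... | no _  = K

  project-complete : ∀ K → IsComplete G K → IsComplete G' (project K)
  project-complete K complete with nonempty? (K ∩ H-only)
  ... | yes _  = C-complete
  ... | no ¬KY = λ u v u∈K v∈K u≢v →
    let a = complete u v u∈K v∈K u≢v in
    adj-within-G' a (∈G' u∈K (proj₁ (adj-verts G a))) (∈G' v∈K (proj₂ (adj-verts G a)))
    where
    ∈G' : ∀ {u} → u ∈ K → u ∈ verts G → u ∈ verts G'
    ∈G' {u} u∈K u∈G with u ∈? verts G'
    ... | yes u∈G' = u∈G'
    ... | no u∉G'  = ⊥-elim (¬KY (u , x∈p∩q⁺ (u∈K , ∉G'⇒∈H-only u∈G u∉G')))

  module _ {S : Subset n} (S⊆G : ∀ x → x ∈ S → x ∈ verts G) (connected : Connected G S) where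

    project-meets : ∀ {y} → y ∈ S → y ∈ verts G' → ∀ K → IsComplete G K →
      Meets K S → Meets (project K) (S ∩ verts G')
    project-meets {y} y∈S y∈G' K complete (x , x∈K∩S) with nonempty? (K ∩ H-only) | x∈p∩q⁻ K S x∈K∩S
    ... | yes (x₀ , x₀∈K∩Y) | x∈K , x∈S with x ∈? verts G'
    ...   | yes x∈G' = x , x∈p∩q⁺ (x∈C , x∈p∩q⁺ (x∈S , x∈G'))
      where
      x₀∈K  = proj₁ (x∈p∩q⁻ K H-only x₀∈K∩Y)
      x₀∉G' = x∈∁p⇒x∉p (proj₂ (x∈p∩q⁻ (verts H) _ (proj₂ (x∈p∩q⁻ K H-only x₀∈K∩Y))))
      x≢x₀ : x ≢ x₀
      x≢x₀ refl = x₀∉G' x∈G'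
      x∈C : x ∈ C
      x∈C with edge-split (complete x x₀ x∈K x₀∈K x≢x₀)
      ... | inj₁ a = ⊥-elim (x₀∉G' (proj₂ (adj-verts G' a)))
      ... | inj₂ h = H-edge-from-G' h x∈G'
    ...   | no x∉G' =
      let c , c∈C , c∈S , _ = proj₂ (restrict-walk (connected x y x∈S y∈S) y∈G') x∉G' in
      c , x∈p∩q⁺ (c∈C , x∈p∩q⁺ (c∈S , proj₁ (x∈p∩q⁻ (verts G') _ c∈C)))
    project-meets y∈S y∈G' K complete (x , _) | no ¬KY | x∈K , x∈S with x ∈? verts G'
    ... | yes x∈G' = x , x∈p∩q⁺ (x∈K , x∈p∩q⁺ (x∈S , x∈G'))
    ... | no x∉G'  = ⊥-elim (¬KY (x , x∈p∩q⁺ (x∈K , ∉G'⇒∈H-only (S⊆G x x∈S) x∉G')))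

    -- Without a vertex in G', S lies in H ∖ G', and C separates it from G-only.
    separated : Empty (S ∩ verts G') → ∀ K → IsComplete G K → Meets K S → Meets K G-only → ⊥
    separated S∩G'=∅ K complete (x , x∈K∩S) (z , z∈K∩X) = no-edge (edge-split (complete x z x∈K z∈K x≢z))
      where
      x∈K = proj₁ (x∈p∩q⁻ K S x∈K∩S)
      x∈S = proj₂ (x∈p∩q⁻ K S x∈K∩S)
      z∈K = proj₁ (x∈p∩q⁻ K G-only z∈K∩X)
      x∉G' : x ∉ verts G'
      x∉G' x∈G' = S∩G'=∅ (x , x∈p∩q⁺ (x∈S , x∈G'))
      z∉H : z ∉ verts H
      z∉H = x∈∁p⇒x∉p (proj₂ (x∈p∩q⁻ (verts G) _ (proj₂ (x∈p∩q⁻ K G-only z∈K∩X))))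
      x≢z : x ≢ z
      x≢z refl = z∉H (proj₁ (x∈p∩q⁻ (verts H) _ (∉G'⇒∈H-only (S⊆G x x∈S) x∉G')))
      no-edge : adj G' x z ⊎ adj H x z → ⊥
      no-edge (inj₁ a) = x∉G' (proj₁ (adj-verts G' a))
      no-edge (inj₂ h) = z∉H (proj₂ (adj-verts H h))

  H-balanced : ∀ Ks → 2 * hits G-only Ks ≤ length Ks → Balanced G Ks (verts H)
  H-balanced Ks light S avoids _ = ≤-trans (*-monoʳ-≤ 2 (hits-mono Ks S⊆G-only)) light
    where
    S⊆G-only : S ⊆ G-only
    S⊆G-only {x} x∈S = let x∈G , x∉H = avoids x x∈S in x∈p∩q⁺ (x∈G , x∉p⇒x∈∁p x∉H)

  balanced-from-G' : ∀ {Ks R} → length Ks < 2 * hits G-only Ks → All (IsComplete G) Ks →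
    Balanced G' (map project Ks) R → Balanced G Ks R
  balanced-from-G' {Ks} {R} heavy complete balanced S avoids connected
    with nonempty? (S ∩ verts G')
  ... | yes (y , y∈S∩G') = begin
    2 * hits S Ks                           ≤⟨ *-monoʳ-≤ 2 (hits-map-mono project
                                                 (All.map (project-meets S⊆G connected y∈S y∈G' _) complete)) ⟩
    2 * hits (S ∩ verts G') (map project Ks) ≤⟨ balanced (S ∩ verts G') avoids' connected' ⟩
    length (map project Ks)                 ≡⟨ length-map project Ks ⟩
    length Ks                               ∎
    where
    open ≤-Reasoning
    S⊆G = λ x x∈S → proj₁ (avoids x x∈S)
    y∈S  = proj₁ (x∈p∩q⁻ S _ y∈S∩G')
    y∈G' = proj₂ (x∈p∩q⁻ S _ y∈S∩G')
    avoids' : ∀ x → x ∈ S ∩ verts G' → x ∈ verts G' × x ∉ R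
    avoids' x x∈S' = let x∈S , x∈G' = x∈p∩q⁻ S _ x∈S' in x∈G' , proj₂ (avoids x x∈S)
    connected' : Connected G' (S ∩ verts G')
    connected' x z x∈S' z∈S' =
      let x∈S , x∈G' = x∈p∩q⁻ S _ x∈S' ; z∈S , z∈G' = x∈p∩q⁻ S _ z∈S' in
      proj₁ (restrict-walk (connected x z x∈S z∈S) z∈G') x∈G'
  ... | no S∩G'=∅ = less-than-half (hits S Ks) (hits G-only Ks) (length Ks)
      (hits-disjoint (All.map (separated (λ x x∈S → proj₁ (avoids x x∈S)) connected S∩G'=∅ _) complete))
      heavy

  balanced-step : ∀ {Hs} Ks → All (IsComplete G) Ks →
    (∀ Ks′ → All (IsComplete G') Ks′ → Any (λ H′ → Balanced G' Ks′ (verts H′)) Hs) →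
    Any (λ H′ → Balanced G Ks (verts H′)) (Hs ∷ʳ H)
  balanced-step {Hs} Ks complete induction with 2 * hits G-only Ks ≤? length Ks
  ... | yes light = ++⁺ʳ Hs (Any.here (H-balanced Ks light))
  ... | no heavy  = ++⁺ˡ (Any.map (balanced-from-G' (≰⇒> heavy) complete)
                       (induction (map project Ks) (map⁺ (All.map (project-complete _) complete))))

balanced-part : ∀ {k Hs} {G : SGraph n} → CliqueSumList k Hs G →
  ∀ Ks → All (IsComplete G) Ks → Any (λ H → Balanced G Ks (verts H)) Hs
balanced-part (single H) Ks _ = Any.here λ S avoids _ →
  let S-empty = λ (x , x∈S) → let x∈H , x∉H = avoids x x∈S in x∉H x∈H in
  subst (λ w → 2 * w ≤ length Ks) (sym (hits-empty Ks S-empty)) z≤n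
balanced-part (step {G' = G'} {H} {G} cs isSum) Ks complete =
  CliqueSumStep.balanced-step _ G' H G isSum Ks complete (balanced-part cs)

IsSubsingleton : Subset n → Set
IsSubsingleton K = ∀ {u v} → u ∈ K → v ∈ K → u ≡ v

subsingleton⇒complete : ∀ {G : SGraph n} {K} → IsSubsingleton K → IsComplete G K
subsingleton⇒complete same u v u∈K v∈K u≢v = ⊥-elim (u≢v (same u∈K v∈K))

-- The singletons of the elements of V, so that hits S (points V) counts S ∩ V.
points : Subset n → List (Subset n)
points []            = []
points (inside ∷ V)  = ⁅ zero ⁆ ∷ map (outside ∷_) (points V)
points (outside ∷ V) = map (outside ∷_) (points V)

length-points : ∀ (V : Subset n) → length (points V) ≡ ∣ V ∣
length-points []            = refl
length-points (inside ∷ V)  = cong suc (trans (length-map (outside ∷_) (points V)) (length-points V))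
length-points (outside ∷ V) = trans (length-map (outside ∷_) (points V)) (length-points V)

⁅⁆-subsingleton : ∀ (y : Fin n) → IsSubsingleton ⁅ y ⁆
⁅⁆-subsingleton y u∈⁅y⁆ v∈⁅y⁆ = trans (x∈⁅y⁆⇒x≡y y u∈⁅y⁆) (sym (x∈⁅y⁆⇒x≡y y v∈⁅y⁆))

shift-subsingleton : ∀ {K : Subset n} → IsSubsingleton K → IsSubsingleton (outside ∷ K)
shift-subsingleton same (there u∈K) (there v∈K) = cong suc (same u∈K v∈K)

points-subsingleton : ∀ (V : Subset n) → All IsSubsingleton (points V)
points-subsingleton []            = []
points-subsingleton (inside ∷ V)  =
  ⁅⁆-subsingleton zero ∷ map⁺ (All.map shift-subsingleton (points-subsingleton V))
points-subsingleton (outside ∷ V) = map⁺ (All.map shift-subsingleton (points-subsingleton V))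

hits-shift : ∀ {b} {S : Subset n} Ks → hits S Ks ≤ hits (b ∷ S) (map (outside ∷_) Ks)
hits-shift Ks = hits-map-mono (outside ∷_) (All.universal (λ _ (x , x∈K∩S) → suc x , there x∈K∩S) Ks)

∣S∣≤hits-points : ∀ {S : Subset n} V → S ⊆ V → ∣ S ∣ ≤ hits S (points V)
∣S∣≤hits-points {S = []} [] _ = z≤n
∣S∣≤hits-points {S = inside ∷ S} (inside ∷ V) S⊆V =
  +-mono-≤ (𝟙-mono (yes tt) (nonempty? (⁅ zero ⁆ ∩ (inside ∷ S))) (λ _ → zero , here))
           (≤-trans (∣S∣≤hits-points V (drop-∷-⊆ S⊆V)) (hits-shift (points V)))
∣S∣≤hits-points {S = outside ∷ S} (inside ∷ V) S⊆V =
  ≤-trans (≤-trans (∣S∣≤hits-points V (drop-∷-⊆ S⊆V)) (hits-shift (points V))) (m≤n+m _ _)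
∣S∣≤hits-points {S = inside ∷ S} (outside ∷ V) S⊆V with S⊆V here
... | ()
∣S∣≤hits-points {S = outside ∷ S} (outside ∷ V) S⊆V =
  ≤-trans (∣S∣≤hits-points V (drop-∷-⊆ S⊆V)) (hits-shift (points V))

lemma5p4 : ∀ {n : ℕ} (k : ℕ) (Hs : List (SGraph n)) (G : SGraph n) →
    CliqueSumList k Hs G →
    Any (λ H → ∀ (S : Subset n) → IsFlap G (verts H) S → 2 * ∣ S ∣ ≤ ∣ verts G ∣) Hs
lemma5p4 k Hs G cs = Any.map (λ {H} → flap-bound {H}) (balanced-part cs (points V) unit-cliques)
  where
  V = verts G

  unit-cliques : All (IsComplete G) (points V)
  unit-cliques = All.map (subsingleton⇒complete {G = G}) (points-subsingleton V)

  flap-bound : ∀ {H} → Balanced G (points V) (verts H) → ∀ S → IsFlap G (verts H) S → 2 * ∣ S ∣ ≤ ∣ V ∣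
  flap-bound balanced S (avoids , _ , connected , _) = begin
    2 * ∣ S ∣             ≤⟨ *-monoʳ-≤ 2 (∣S∣≤hits-points V λ {x} x∈S → proj₁ (avoids x x∈S)) ⟩
    2 * hits S (points V) ≤⟨ balanced S avoids connected ⟩
    length (points V)     ≡⟨ length-points V ⟩
    ∣ V ∣                 ∎
    where open ≤-Reasoning
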